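{- Let $m = p_1^{e_1}\cdots p_r^{e_r}$, $R=\{1,\dots,r\}$, $I\subseteq R$, $U=(\mathbb{Z}/m\mathbb{Z})^\times$, and suppose $d_I \neq 0$. Regarding each element of $d_IU$ as its representative in $\{0,1,\ldots,m-1\}$ and summing as integers, $$\sum_{v\in d_IU} v = \frac{1}{\phi(g_I)}\sum_{u\in U} u = \frac{m\,\phi(m)}{2\,\phi(g_I)}.$$
   Context: $m = p_1^{e_1}\cdots p_r^{e_r}$ with distinct primes, $e_i\ge1$; $\phi$ is Euler's totient function. For $I\subseteq R$: $g_I=\prod_{i\in I}p_i^{e_i}$ ($g_\emptyset=1$), $d_I$ is the idempotent of $\mathbb{Z}/m\mathbb{Z}$ with $d_I\equiv 0\pmod{p_i^{e_i}}$ for $i\in I$ and $d_I\equiv1\pmod{p_j^{e_j}}$ for $j\notin I$, and $d_IU = \{d_Iu \bmod m: u\in U\}$; the sum over $U$ is also over representatives in $\{0,\ldots,m-1\}$. -}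

module Defs where

open import Data.Nat using (ℕ; zero; suc; _*_; _^_; _≟_)
open import Data.Nat.DivMod using (_%_)
open import Data.Nat.Coprimality using (coprime?)
open import Data.Nat.ListAction using (sum; product)
open import Data.Bool using (Bool; if_then_else_)
open import Data.Fin using (Fin)
open import Data.List using (List; map; filter; upTo; allFin; length)
open import Data.List.Relation.Unary.Any using (any?)

-- remainder of a modulo n, with the (unused here) convention a mod 0 = a
_mod_ : ℕ → ℕ → ℕ
a mod zero = a
a mod suc k = a % suc k

-- Euler's totient: number of 0 ≤ k < n with gcd(k,n) = 1  (φ 1 = 1)
φ : ℕ → ℕ
φ n = length (filter (λ k → coprime? k n) (upTo n))

-- representatives in {0,…,m-1} of the unit group U = (ℤ/mℤ)ˣ
Units : ℕ → List ℕ
Units m = filter (λ u → coprime? u m) (upTo m)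

-- the set d·U = { d*u mod m : u ∈ U }, each element listed once,
-- as its representative in {0,…,m-1}
scaledUnits : ℕ → ℕ → List ℕ
scaledUnits m d = filter (λ v → any? (λ u → (d * u) mod m ≟ v) (Units m)) (upTo m)

ppow : ∀ {r} → (Fin r → ℕ) → (Fin r → ℕ) → Fin r → ℕ
ppow p e i = p i ^ e i

modulus : ∀ r → (Fin r → ℕ) → (Fin r → ℕ) → ℕ
modulus r p e = product (map (ppow p e) (allFin r))

-- g_I = ∏_{i ∈ I} p_i^{e_i}, with I given by its indicator function
gI : ∀ r → (Fin r → ℕ) → (Fin r → ℕ) → (Fin r → Bool) → ℕ
gI r p e I = product (map (λ i → if I i then ppow p e i else 1) (allFin r))

-- Split m = G·H with G = g_I = ∏_{i∈I} p_i^{e_i} and H = ∏_{i∉I} p_i^{e_i};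
-- these are coprime, and the idempotent d satisfies G ∣ d and H ∣ d − 1.
-- For 0 ≤ v < m one then has
--     v ∈ d·U   ⇔   G ∣ v  and  gcd(v, H) = 1,
-- the backward direction by the Chinese remainder theorem.  Writing v = qG
-- shows |d·U| = φ(H), so φ(G)·|d·U| = φ(m) by multiplicativity of φ.  Both
-- d·U and U avoid 0 and are stable under v ↦ m − v, so the sum of each is
-- m/2 times its size: 2·Σ d·U = m·φ(H) and 2·Σ U = m·φ(m).  Hence
-- 2·φ(G)·Σ d·U = m·φ(m) = 2·Σ U, which is the theorem.
module Submission where

open import Defs
open import Data.Nat
open import Data.Nat.Properties
open import Data.Nat.DivMod hiding (_mod_)
open import Data.Nat.Divisibility
open import Data.Nat.Coprimality using (Coprime; coprime?; coprime-divisor)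
import Data.Nat.Coprimality as Coprime
open import Data.Nat.Primality using (Prime; prime⇒irreducible)
open import Data.Nat.ListAction using (sum; product)
open import Data.Nat.ListAction.Properties using (sum-++)
open import Data.Nat.Tactic.RingSolver using (solve-∀)
open import Data.Bool using (Bool; true; false; not; if_then_else_)
open import Data.Fin using (Fin)
open import Data.Fin.Properties using () renaming (_≟_ to _≟ᶠ_)
open import Data.List using ([]; _∷_; _++_; map; filter; upTo; allFin; length)
open import Data.List.Properties using (applyUpTo-∷ʳ; filter-++; length-++)
open import Data.List.Relation.Unary.All using (All; []; _∷_)
import Data.List.Relation.Unary.All.Properties as Allₚ
open import Data.List.Relation.Unary.AllPairs as AllPairs using (AllPairs; []; _∷_)
import Data.List.Relation.Unary.AllPairs.Properties as AllPairsₚ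
open import Data.List.Relation.Unary.Any using (Any; any?)
open import Data.List.Relation.Unary.Unique.Propositional.Properties using (allFin⁺)
open import Data.List.Membership.Propositional using (_∈_; lose; find)
open import Data.List.Membership.Propositional.Properties using (∈-filter⁺; ∈-filter⁻; ∈-upTo⁺)
open import Data.Product using (_×_; _,_; proj₂)
open import Data.Sum using (inj₁; inj₂)
open import Data.Empty using (⊥-elim)
open import Function using (_∘_)
open import Function.Definitions using (Injective)
open import Relation.Nullary using (Dec; yes; no; ¬_)
open import Relation.Nullary.Decidable using (_×-dec_)
open import Relation.Unary using (Decidable)
open import Relation.Binary.PropositionalEquality

∑ : ℕ → (ℕ → ℕ) → ℕ
∑ zero    f = 0
∑ (suc n) f = ∑ n f + f n

𝟙 : ∀ {a} {A : Set a} → Dec A → ℕ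
𝟙 (yes _) = 1
𝟙 (no _)  = 0

𝟙-cong : ∀ {a b} {A : Set a} {B : Set b} → (A → B) → (B → A) →
         (A? : Dec A) (B? : Dec B) → 𝟙 A? ≡ 𝟙 B?
𝟙-cong A→B B→A (yes _) (yes _) = refl
𝟙-cong A→B B→A (no _)  (no _)  = refl
𝟙-cong A→B B→A (yes a) (no ¬b) = ⊥-elim (¬b (A→B a))
𝟙-cong A→B B→A (no ¬a) (yes b) = ⊥-elim (¬a (B→A b))

𝟙-× : ∀ {a b} {A : Set a} {B : Set b} (A? : Dec A) (B? : Dec B) →
      𝟙 (A? ×-dec B?) ≡ 𝟙 A? * 𝟙 B?
𝟙-× (yes _) (yes _) = refl
𝟙-× (yes _) (no _)  = refl
𝟙-× (no _)  _       = refl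

𝟙-no : ∀ {a} {A : Set a} → ¬ A → (A? : Dec A) → 𝟙 A? ≡ 0
𝟙-no ¬a (yes a) = ⊥-elim (¬a a)
𝟙-no ¬a (no _)  = refl

∑-cong : ∀ n {f g : ℕ → ℕ} → (∀ x → x < n → f x ≡ g x) → ∑ n f ≡ ∑ n g
∑-cong zero    f≡g = refl
∑-cong (suc n) f≡g = cong₂ _+_ (∑-cong n (λ x x<n → f≡g x (m≤n⇒m≤1+n x<n))) (f≡g n ≤-refl)

∑-+ : ∀ n f g → ∑ n (λ x → f x + g x) ≡ ∑ n f + ∑ n g
∑-+ zero    f g = refl
∑-+ (suc n) f g rewrite ∑-+ n f g = interchange (∑ n f) (∑ n g) (f n) (g n)
  where
  interchange : ∀ a b c d → (a + b) + (c + d) ≡ (a + c) + (b + d)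
  interchange = solve-∀

∑-*ˡ : ∀ n c f → ∑ n (λ x → c * f x) ≡ c * ∑ n f
∑-*ˡ zero    c f = sym (*-zeroʳ c)
∑-*ˡ (suc n) c f rewrite ∑-*ˡ n c f = sym (*-distribˡ-+ c (∑ n f) (f n))

∑-*ʳ : ∀ n f c → ∑ n (λ x → f x * c) ≡ ∑ n f * c
∑-*ʳ n f c = begin
  ∑ n (λ x → f x * c)  ≡⟨ ∑-cong n (λ x _ → *-comm (f x) c) ⟩
  ∑ n (λ x → c * f x)  ≡⟨ ∑-*ˡ n c f ⟩
  c * ∑ n f            ≡⟨ *-comm c (∑ n f) ⟩
  ∑ n f * c            ∎
  where open ≡-Reasoning

∑-zero : ∀ n f → (∀ x → x < n → f x ≡ 0) → ∑ n f ≡ 0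
∑-zero n f f≡0 = trans (∑-cong n f≡0) (zeros n)
  where
  zeros : ∀ n → ∑ n (λ _ → 0) ≡ 0
  zeros zero    = refl
  zeros (suc n) = trans (+-identityʳ _) (zeros n)

∑-ones : ∀ n → ∑ n (λ _ → 1) ≡ n
∑-ones zero    = refl
∑-ones (suc n) = trans (cong (_+ 1) (∑-ones n)) (+-comm n 1)

∑-front : ∀ n f → ∑ (suc n) f ≡ f 0 + ∑ n (f ∘ suc)
∑-front zero    f = +-comm 0 (f 0)
∑-front (suc n) f rewrite ∑-front n f = +-assoc (f 0) (∑ n (f ∘ suc)) (f (suc n))

∑-reverse : ∀ n f → ∑ n f ≡ ∑ n (λ x → f (n ∸ suc x))
∑-reverse zero    f = refl
∑-reverse (suc n) f = begin
  ∑ n f + f n                          ≡⟨ cong (_+ f n) (∑-reverse n f) ⟩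
  ∑ n (λ x → f (n ∸ suc x)) + f n      ≡⟨ +-comm _ (f n) ⟩
  f n + ∑ n (λ x → f (n ∸ suc x))      ≡⟨ ∑-front n (λ x → f (suc n ∸ suc x)) ⟨
  ∑ (suc n) (λ x → f (suc n ∸ suc x))  ∎
  where open ≡-Reasoning

∑-append : ∀ a b f → ∑ (a + b) f ≡ ∑ a f + ∑ b (λ x → f (a + x))
∑-append a zero    f rewrite +-identityʳ a = sym (+-identityʳ _)
∑-append a (suc b) f rewrite +-suc a b | ∑-append a b f = +-assoc (∑ a f) _ _

∑-blocks : ∀ A B f → ∑ (A * B) f ≡ ∑ A (λ k → ∑ B (λ b → f (k * B + b)))
∑-blocks zero    B f = refl
∑-blocks (suc A) B f = begin
  ∑ (B + A * B) f
    ≡⟨ ∑-append B (A * B) f ⟩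
  ∑ B f + ∑ (A * B) (λ x → f (B + x))
    ≡⟨ cong (∑ B f +_) (∑-blocks A B (λ x → f (B + x))) ⟩
  ∑ B f + ∑ A (λ k → ∑ B (λ b → f (B + (k * B + b))))
    ≡⟨ cong (∑ B f +_) (∑-cong A (λ k _ → ∑-cong B (λ b _ → cong f (sym (+-assoc B (k * B) b))))) ⟩
  ∑ B f + ∑ A (λ k → ∑ B (λ b → f (suc k * B + b)))
    ≡⟨ ∑-front A (λ k → ∑ B (λ b → f (k * B + b))) ⟨
  ∑ (suc A) (λ k → ∑ B (λ b → f (k * B + b)))
    ∎
  where open ≡-Reasoning

∑-swap : ∀ A B (f : ℕ → ℕ → ℕ) → ∑ A (λ a → ∑ B (f a)) ≡ ∑ B (λ b → ∑ A (λ a → f a b))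
∑-swap zero    B f = sym (∑-zero B _ (λ _ _ → refl))
∑-swap (suc A) B f rewrite ∑-swap A B f = sym (∑-+ B (λ b → ∑ A (λ a → f a b)) (f A))

∑-δ : ∀ n c (g : ℕ → ℕ) → c < n → ∑ n (λ y → 𝟙 (c ≟ y) * g y) ≡ g c
∑-δ (suc n) c g c<1+n with c ≟ n
... | yes refl = trans (cong (_+ (g c + 0)) (∑-zero n _ off-diagonal)) (+-identityʳ (g c))
  where
  off-diagonal : ∀ x → x < c → 𝟙 (c ≟ x) * g x ≡ 0
  off-diagonal x x<c = cong (_* g x) (𝟙-no (λ c≡x → <-irrefl (sym c≡x) x<c) (c ≟ x))
... | no c≢n = trans (+-identityʳ _) (∑-δ n c g (≤∧≢⇒< (≤-pred c<1+n) c≢n))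

∑-𝟙-unique : ∀ n {P : ℕ → Set} (P? : Decidable P) →
             (∀ x y → x < n → y < n → P x → P y → x ≡ y) → ∑ n (λ x → 𝟙 (P? x)) ≤ 1
∑-𝟙-unique zero    P? unique = z≤n
∑-𝟙-unique (suc n) {P} P? unique with P? n
... | no _  = subst (_≤ 1) (sym (+-identityʳ _)) (∑-𝟙-unique n P? unique-below-n)
  where
  unique-below-n : ∀ x y → x < n → y < n → P x → P y → x ≡ y
  unique-below-n x y x<n y<n = unique x y (m≤n⇒m≤1+n x<n) (m≤n⇒m≤1+n y<n)
... | yes Pn = ≤-reflexive (cong (_+ 1) (∑-zero n _ none-below-n))
  where
  none-below-n : ∀ x → x < n → 𝟙 (P? x) ≡ 0
  none-below-n x x<n = 𝟙-no (λ Px → <-irrefl (unique x n (m≤n⇒m≤1+n x<n) ≤-refl Px Pn) x<n) (P? x)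

∑-bounded : ∀ n f → (∀ x → x < n → f x ≤ 1) → ∑ n f ≤ n
∑-bounded zero    f f≤1 = z≤n
∑-bounded (suc n) f f≤1 = subst (∑ n f + f n ≤_) (+-comm n 1)
  (+-mono-≤ (∑-bounded n f (λ x x<n → f≤1 x (m≤n⇒m≤1+n x<n))) (f≤1 n ≤-refl))

+-tight : ∀ {a b n} → a ≤ n → b ≤ 1 → a + b ≡ suc n → a ≡ n × b ≡ 1
+-tight {a} {0} {n} a≤n _ a+0≡1+n =
  ⊥-elim (<-irrefl refl (subst (_≤ n) (trans (sym (+-identityʳ a)) a+0≡1+n) a≤n))
+-tight {a} {1} _ _ a+1≡1+n = suc-injective (trans (+-comm 1 a) a+1≡1+n) , refl
+-tight {b = suc (suc _)} _ (s≤s ()) _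

∑-saturated : ∀ n f → (∀ x → x < n → f x ≤ 1) → ∑ n f ≡ n → ∀ x → x < n → f x ≡ 1
∑-saturated (suc n) f f≤1 total x x<1+n
  with +-tight (∑-bounded n f (λ y y<n → f≤1 y (m≤n⇒m≤1+n y<n))) (f≤1 n ≤-refl) total | x ≟ n
... | _ , fn≡1 | yes refl = fn≡1
... | ∑≡n , _  | no x≢n   = ∑-saturated n f (λ y y<n → f≤1 y (m≤n⇒m≤1+n y<n)) ∑≡n x
                              (≤∧≢⇒< (≤-pred x<1+n) x≢n)

-- an injective map of [0, n) into itself permutes the terms of a sum:
-- each value y < n is hit by exactly one x, since at most one is hit and
-- the fibre sizes add up to n
∑-permute : ∀ n (σ : ℕ → ℕ) (f : ℕ → ℕ) → (∀ x → x < n → σ x < n) →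
            (∀ x y → x < n → y < n → σ x ≡ σ y → x ≡ y) → ∑ n (f ∘ σ) ≡ ∑ n f
∑-permute n σ f σ<n σ-injective = begin
  ∑ n (f ∘ σ)
    ≡⟨ ∑-cong n (λ x x<n → sym (∑-δ n (σ x) f (σ<n x x<n))) ⟩
  ∑ n (λ x → ∑ n (λ y → 𝟙 (σ x ≟ y) * f y))
    ≡⟨ ∑-swap n n (λ x y → 𝟙 (σ x ≟ y) * f y) ⟩
  ∑ n (λ y → ∑ n (λ x → 𝟙 (σ x ≟ y) * f y))
    ≡⟨ ∑-cong n (λ y _ → ∑-*ʳ n (λ x → 𝟙 (σ x ≟ y)) (f y)) ⟩
  ∑ n (λ y → fibre y * f y)
    ≡⟨ ∑-cong n (λ y y<n → trans (cong (_* f y) (fibre≡1 y y<n)) (*-identityˡ (f y))) ⟩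
  ∑ n f
    ∎
  where
  open ≡-Reasoning
  fibre : ℕ → ℕ
  fibre y = ∑ n (λ x → 𝟙 (σ x ≟ y))
  total : ∑ n fibre ≡ n
  total = begin
    ∑ n fibre                                ≡⟨ ∑-swap n n (λ y x → 𝟙 (σ x ≟ y)) ⟩
    ∑ n (λ x → ∑ n (λ y → 𝟙 (σ x ≟ y)))      ≡⟨ ∑-cong n (λ x _ → ∑-cong n (λ y _ → sym (*-identityʳ _))) ⟩
    ∑ n (λ x → ∑ n (λ y → 𝟙 (σ x ≟ y) * 1))  ≡⟨ ∑-cong n (λ x x<n → ∑-δ n (σ x) (λ _ → 1) (σ<n x x<n)) ⟩
    ∑ n (λ _ → 1)                            ≡⟨ ∑-ones n ⟩
    n                                        ∎
  fibre≡1 : ∀ y → y < n → fibre y ≡ 1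
  fibre≡1 = ∑-saturated n fibre
    (λ y _ → ∑-𝟙-unique n (λ x → σ x ≟ y) (λ x x′ x<n x′<n σx≡y σx′≡y →
              σ-injective x x′ x<n x′<n (trans σx≡y (sym σx′≡y))))
    total

∑-symmetric : ∀ m (c : ℕ → ℕ) → c 0 ≡ 0 → (∀ v → 0 < v → v < m → c v ≡ c (m ∸ v)) →
              2 * ∑ m (λ v → c v * v) ≡ m * ∑ m c
∑-symmetric zero    c c0≡0 reflect = refl
∑-symmetric (suc k) c c0≡0 reflect = begin
  2 * ∑ (suc k) (λ v → c v * v)
    ≡⟨ cong (2 *_) (trans (∑-front k (λ v → c v * v)) (cong (_+ T) (*-zeroʳ (c 0)))) ⟩
  T + (T + 0)
    ≡⟨ cong (T +_) (trans (+-identityʳ T) T-reversed) ⟩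
  T + ∑ k (λ x → c (suc x) * (suc k ∸ suc x))
    ≡⟨ ∑-+ k (λ x → c (suc x) * suc x) (λ x → c (suc x) * (suc k ∸ suc x)) ⟨
  ∑ k (λ x → c (suc x) * suc x + c (suc x) * (suc k ∸ suc x))
    ≡⟨ ∑-cong k (λ x x<k → trans (sym (*-distribˡ-+ (c (suc x)) (suc x) (suc k ∸ suc x)))
                            (trans (cong (c (suc x) *_) (m+[n∸m]≡n (s≤s (<⇒≤ x<k))))
                                   (*-comm (c (suc x)) (suc k)))) ⟩
  ∑ k (λ x → suc k * c (suc x))
    ≡⟨ ∑-*ˡ k (suc k) (c ∘ suc) ⟩
  suc k * ∑ k (c ∘ suc)
    ≡⟨ cong (suc k *_) (trans (∑-front k c) (cong (_+ ∑ k (c ∘ suc)) c0≡0)) ⟨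
  suc k * ∑ (suc k) c
    ∎
  where
  open ≡-Reasoning
  T : ℕ
  T = ∑ k (λ x → c (suc x) * suc x)
  -- reversing T replaces the weight v by suc k − v and keeps c by symmetry
  T-reversed : T ≡ ∑ k (λ x → c (suc x) * (suc k ∸ suc x))
  T-reversed = trans (∑-reverse k (λ x → c (suc x) * suc x)) (∑-cong k reflected)
    where
    reflected : ∀ x → x < k → c (suc (k ∸ suc x)) * suc (k ∸ suc x) ≡ c (suc x) * (suc k ∸ suc x)
    reflected x x<k = begin
      c (suc (k ∸ suc x)) * suc (k ∸ suc x)  ≡⟨ cong (λ z → c z * z) (+-∸-assoc 1 {k} {suc x} x<k) ⟨
      c (suc k ∸ suc x) * (suc k ∸ suc x)    ≡⟨ cong (_* (suc k ∸ suc x)) (reflect (suc x) z<s (s≤s x<k)) ⟨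
      c (suc x) * (suc k ∸ suc x)            ∎

-- v ↦ m ∸ v maps [0, m] onto itself and is an involution there, so a
-- property it preserves is also reflected
complement-reflect : ∀ {m v} {P : ℕ → Set} → (∀ {w} → w ≤ m → P w → P (m ∸ w)) →
                     v ≤ m → P (m ∸ v) → P v
complement-reflect {m} {v} {P} preserve v≤m P[m∸v] =
  subst P (m∸[m∸n]≡n v≤m) (preserve (m∸n≤m m v) P[m∸v])

∑-symmetric-set : ∀ m {P : ℕ → Set} (P? : Decidable P) → ¬ P 0 →
                  (∀ {v} → v ≤ m → P v → P (m ∸ v)) →
                  2 * ∑ m (λ v → 𝟙 (P? v) * v) ≡ m * ∑ m (λ v → 𝟙 (P? v))
∑-symmetric-set m P? ¬P0 preserve = ∑-symmetric m (λ v → 𝟙 (P? v)) (𝟙-no ¬P0 (P? 0))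
  (λ v _ v<m → 𝟙-cong (preserve (<⇒≤ v<m)) (complement-reflect preserve (<⇒≤ v<m))
                      (P? v) (P? (m ∸ v)))

-- summing the multiples of G below n·G: only the term a = 0 of each block survives
∑-multiples : ∀ n G .{{_ : NonZero G}} f →
              ∑ (n * G) (λ v → 𝟙 (G ∣? v) * f v) ≡ ∑ n (λ q → f (q * G))
∑-multiples n G f = begin
  ∑ (n * G) (λ v → 𝟙 (G ∣? v) * f v)
    ≡⟨ ∑-blocks n G _ ⟩
  ∑ n (λ q → ∑ G (λ a → 𝟙 (G ∣? (q * G + a)) * f (q * G + a)))
    ≡⟨ ∑-cong n (λ q _ → ∑-cong G (λ a a<G →
         cong (_* f (q * G + a)) (𝟙-cong (only-zero q a<G) (zero-divides q) (G ∣? _) (0 ≟ a)))) ⟩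
  ∑ n (λ q → ∑ G (λ a → 𝟙 (0 ≟ a) * f (q * G + a)))
    ≡⟨ ∑-cong n (λ q _ → ∑-δ G 0 (λ a → f (q * G + a)) (>-nonZero⁻¹ G)) ⟩
  ∑ n (λ q → f (q * G + 0))
    ≡⟨ ∑-cong n (λ q _ → cong f (+-identityʳ (q * G))) ⟩
  ∑ n (λ q → f (q * G))
    ∎
  where
  open ≡-Reasoning
  only-zero : ∀ q {a} → a < G → G ∣ q * G + a → 0 ≡ a
  only-zero q {zero}  _   _       = refl
  only-zero q {suc a} a<G G∣qG+a =
    ⊥-elim (<⇒≱ a<G (∣⇒≤ (∣m+n∣m⇒∣n G∣qG+a (n∣m*n q))))
  zero-divides : ∀ q {a} → 0 ≡ a → G ∣ q * G + a
  zero-divides q refl = subst (G ∣_) (sym (+-identityʳ (q * G))) (n∣m*n q)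

filter-upTo-suc : ∀ {P : ℕ → Set} (P? : Decidable P) n →
                  filter P? (upTo (suc n)) ≡ filter P? (upTo n) ++ filter P? (n ∷ [])
filter-upTo-suc P? n =
  trans (cong (filter P?) (sym (applyUpTo-∷ʳ (λ x → x) n))) (filter-++ P? (upTo n) (n ∷ []))

length-filter-upTo : ∀ {P : ℕ → Set} (P? : Decidable P) n →
                     length (filter P? (upTo n)) ≡ ∑ n (λ x → 𝟙 (P? x))
length-filter-upTo P? zero = refl
length-filter-upTo P? (suc n)
  rewrite filter-upTo-suc P? n | length-++ (filter P? (upTo n)) {filter P? (n ∷ [])}
        | length-filter-upTo P? n with P? n
... | yes _ = refl
... | no _  = refl

sum-filter-upTo : ∀ {P : ℕ → Set} (P? : Decidable P) n →
                  sum (filter P? (upTo n)) ≡ ∑ n (λ x → 𝟙 (P? x) * x)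
sum-filter-upTo P? zero = refl
sum-filter-upTo P? (suc n)
  rewrite filter-upTo-suc P? n | sum-++ (filter P? (upTo n)) (filter P? (n ∷ []))
        | sum-filter-upTo P? n with P? n
... | yes _ = cong (∑ n (λ x → 𝟙 (P? x) * x) +_) (trans (+-identityʳ n) (sym (+-identityʳ n)))
... | no _  = refl

φ-as-∑ : ∀ n → φ n ≡ ∑ n (λ k → 𝟙 (coprime? k n))
φ-as-∑ n = length-filter-upTo (λ k → coprime? k n) n

mod≡% : ∀ a n .{{_ : NonZero n}} → a mod n ≡ a % n
mod≡% a (suc n) = refl

%-+-multiple : ∀ x {k n} .{{_ : NonZero n}} → n ∣ k → (x + k) % n ≡ x % n
%-+-multiple x {n = n} (divides q refl) = [m+kn]%n≡m%n x q n

%-*-≡1 : ∀ {a} u {n} .{{_ : NonZero n}} → a % n ≡ 1 % n → (a * u) % n ≡ u % n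
%-*-≡1 {a} u {n} a≡1 = begin
  (a * u) % n              ≡⟨ %-distribˡ-* a u n ⟩
  (a % n * (u % n)) % n    ≡⟨ cong (λ z → (z * (u % n)) % n) a≡1 ⟩
  (1 % n * (u % n)) % n    ≡⟨ %-distribˡ-* 1 u n ⟨
  (1 * u) % n              ≡⟨ cong (_% n) (*-identityˡ u) ⟩
  u % n                    ∎
  where open ≡-Reasoning

%-*-reduceʳ : ∀ a b n .{{_ : NonZero n}} → (a * (b % n)) % n ≡ (a * b) % n
%-*-reduceʳ a b n = begin
  (a * (b % n)) % n            ≡⟨ %-distribˡ-* a (b % n) n ⟩
  (a % n * (b % n % n)) % n    ≡⟨ cong (λ z → (a % n * z) % n) (m%n%n≡m%n b n) ⟩
  (a % n * (b % n)) % n        ≡⟨ %-distribˡ-* a b n ⟨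
  (a * b) % n                  ∎
  where open ≡-Reasoning

%-≡⇒∣∸ : ∀ {x y} n .{{_ : NonZero n}} → x % n ≡ y % n → n ∣ y ∸ x
%-≡⇒∣∸ {x} {y} n x≡y = divides (y / n ∸ x / n) (begin
  y ∸ x                                       ≡⟨ cong₂ _∸_ (m≡m%n+[m/n]*n y n) (m≡m%n+[m/n]*n x n) ⟩
  (y % n + y / n * n) ∸ (x % n + x / n * n)   ≡⟨ cong (λ z → (y % n + y / n * n) ∸ (z + x / n * n)) x≡y ⟩
  (y % n + y / n * n) ∸ (y % n + x / n * n)   ≡⟨ [m+n]∸[m+o]≡n∸o (y % n) _ _ ⟩
  y / n * n ∸ x / n * n                       ≡⟨ *-distribʳ-∸ n (y / n) (x / n) ⟨
  (y / n ∸ x / n) * n                         ∎)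
  where open ≡-Reasoning

∣∸⇒%-≡ : ∀ {x y n} .{{_ : NonZero n}} → x ≤ y → n ∣ y ∸ x → x % n ≡ y % n
∣∸⇒%-≡ {x} {y} {n} x≤y n∣y∸x = trans (sym (%-+-multiple x n∣y∸x)) (%-congˡ (m+[n∸m]≡n x≤y))

mod-≡⇒∣∸ : ∀ n {x y} → x mod n ≡ y mod n → n ∣ y ∸ x
mod-≡⇒∣∸ zero    {x} refl     = subst (0 ∣_) (sym (n∸n≡0 x)) (0 ∣0)
mod-≡⇒∣∸ (suc n) {x} {y} x≡y = %-≡⇒∣∸ {x} {y} (suc n) x≡y

%-injective-below : ∀ {x y n} .{{_ : NonZero n}} → x < n → y < n → x % n ≡ y % n → x ≡ y
%-injective-below x<n y<n x≡y = trans (sym (m<n⇒m%n≡m x<n)) (trans x≡y (m<n⇒m%n≡m y<n))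

∣-complement : ∀ {i m v} → i ∣ m → v ≤ m → i ∣ v → i ∣ m ∸ v
∣-complement {i} i∣m v≤m i∣v = ∣m+n∣m⇒∣n (subst (i ∣_) (sym (m+[n∸m]≡n v≤m)) i∣m) i∣v

coprime-∣ : ∀ {a b x y} → a ∣ x → b ∣ y → Coprime x y → Coprime a b
coprime-∣ a∣x b∣y x⊥y (i∣a , i∣b) = x⊥y (∣-trans i∣a a∣x , ∣-trans i∣b b∣y)

coprime-* : ∀ {x y z} → Coprime x y → Coprime x z → Coprime x (y * z)
coprime-* x⊥y x⊥z (i∣x , i∣yz) = x⊥z (i∣x , coprime-divisor (coprime-∣ i∣x ∣-refl x⊥y) i∣yz)

coprime-1ˡ : ∀ n → Coprime 1 n
coprime-1ˡ n (i∣1 , _) = ∣1⇒≡1 i∣1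

coprime-1ʳ : ∀ n → Coprime n 1
coprime-1ʳ n (_ , i∣1) = ∣1⇒≡1 i∣1

coprime-0⇒≡1 : ∀ {n} → Coprime 0 n → n ≡ 1
coprime-0⇒≡1 {n} 0⊥n = 0⊥n (n ∣0 , ∣-refl)

coprime-mod : ∀ {x y n} .{{_ : NonZero n}} → x % n ≡ y % n → Coprime x n → Coprime y n
coprime-mod {n = n} x≡y x⊥n (i∣y , i∣n) =
  x⊥n (∣n∣m%n⇒∣m i∣n (subst (_ ∣_) (sym x≡y) (%-presˡ-∣ i∣y i∣n)) , i∣n)

coprime-complement : ∀ {H m v} → H ∣ m → v ≤ m → Coprime v H → Coprime (m ∸ v) H
coprime-complement H∣m v≤m v⊥H (i∣m∸v , i∣H) =
  v⊥H (complement-reflect (∣-complement (∣-trans i∣H H∣m)) v≤m i∣m∸v , i∣H)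

coprime-pow : ∀ {a b} k l → Coprime a b → Coprime (a ^ k) (b ^ l)
coprime-pow k l a⊥b = Coprime.sym (powʳ k (Coprime.sym (powʳ l a⊥b)))
  where
  powʳ : ∀ {x y} l → Coprime x y → Coprime x (y ^ l)
  powʳ {x} zero    _   = coprime-1ʳ x
  powʳ     (suc l) x⊥y = coprime-* x⊥y (powʳ l x⊥y)

coprime-∣-product : ∀ {a b z} → Coprime a b → a ∣ z → b ∣ z → a * b ∣ z
coprime-∣-product {a} {b} a⊥b (divides k refl) b∣ka
  with coprime-divisor (Coprime.sym a⊥b) (subst (b ∣_) (*-comm k a) b∣ka)
... | divides j refl = divides j (trans (*-assoc j b a) (cong (j *_) (*-comm b a)))

-- products of nonzero numbers are nonzero (lets `_%_` be used modulo G * H)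
instance
  *-nonZero : ∀ {m n} .{{_ : NonZero m}} .{{_ : NonZero n}} → NonZero (m * n)
  *-nonZero {m} {n} = m*n≢0 m n

crt : ∀ {G H x y} .{{_ : NonZero G}} .{{_ : NonZero H}} → Coprime G H →
      x % G ≡ y % G → x % H ≡ y % H → x % (G * H) ≡ y % (G * H)
crt {G} {H} {x} {y} G⊥H x≡y[G] x≡y[H] with ≤-total x y
... | inj₁ x≤y = ∣∸⇒%-≡ x≤y
                   (coprime-∣-product G⊥H (%-≡⇒∣∸ G x≡y[G]) (%-≡⇒∣∸ H x≡y[H]))
... | inj₂ y≤x = sym (∣∸⇒%-≡ y≤x
                   (coprime-∣-product G⊥H (%-≡⇒∣∸ G (sym x≡y[G])) (%-≡⇒∣∸ H (sym x≡y[H]))))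

-- for H coprime to G, the map k ↦ (k·H + b) mod G permutes [0, G), so the
-- shifted progression k·H + b (k < G) contains exactly φ(G) units modulo G
progression-units : ∀ {G H} .{{_ : NonZero G}} → Coprime G H → ∀ b →
                    ∑ G (λ k → 𝟙 (coprime? (k * H + b) G)) ≡ φ G
progression-units {G} {H} G⊥H b = begin
  ∑ G (λ k → 𝟙 (coprime? (k * H + b) G))
    ≡⟨ ∑-cong G (λ k _ → 𝟙-cong (coprime-mod (sym (m%n%n≡m%n (k * H + b) G)))
                                (coprime-mod (m%n%n≡m%n (k * H + b) G)) _ _) ⟩
  ∑ G (λ k → 𝟙 (coprime? (σ k) G))
    ≡⟨ ∑-permute G σ (λ y → 𝟙 (coprime? y G)) (λ k _ → m%n<n (k * H + b) G) σ-injective ⟩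
  ∑ G (λ k → 𝟙 (coprime? k G))
    ≡⟨ φ-as-∑ G ⟨
  φ G
    ∎
  where
  open ≡-Reasoning
  σ : ℕ → ℕ
  σ k = (k * H + b) % G
  -- σ x ≡ σ y with x ≤ y makes G divide (y ∸ x)·H, hence y ∸ x
  ordered : ∀ {x y} → x ≤ y → x < G → y < G → σ x ≡ σ y → x ≡ y
  ordered {x} {y} x≤y x<G y<G σx≡σy = %-injective-below x<G y<G (∣∸⇒%-≡ x≤y G∣y∸x)
    where
    difference : (y * H + b) ∸ (x * H + b) ≡ H * (y ∸ x)
    difference = begin
      (y * H + b) ∸ (x * H + b)   ≡⟨ cong₂ _∸_ (+-comm (y * H) b) (+-comm (x * H) b) ⟩
      (b + y * H) ∸ (b + x * H)   ≡⟨ [m+n]∸[m+o]≡n∸o b (y * H) (x * H) ⟩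
      y * H ∸ x * H               ≡⟨ *-distribʳ-∸ H y x ⟨
      (y ∸ x) * H                 ≡⟨ *-comm (y ∸ x) H ⟩
      H * (y ∸ x)                 ∎
    G∣y∸x : G ∣ y ∸ x
    G∣y∸x = coprime-divisor G⊥H (subst (G ∣_) difference (%-≡⇒∣∸ G σx≡σy))
  σ-injective : ∀ x y → x < G → y < G → σ x ≡ σ y → x ≡ y
  σ-injective x y x<G y<G σx≡σy with ≤-total x y
  ... | inj₁ x≤y = ordered x≤y x<G y<G σx≡σy
  ... | inj₂ y≤x = sym (ordered y≤x y<G x<G (sym σx≡σy))

-- φ(G·H) = φ(G)·φ(H) for coprime G, H: write u < G·H as u = k·H + b and use
-- that u is a unit mod G·H iff b is a unit mod H and u is a unit mod G
φ-multiplicative : ∀ G H .{{_ : NonZero G}} .{{_ : NonZero H}} → Coprime G H →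
                   φ (G * H) ≡ φ G * φ H
φ-multiplicative G H G⊥H = begin
  φ (G * H)
    ≡⟨ φ-as-∑ (G * H) ⟩
  ∑ (G * H) (λ u → 𝟙 (coprime? u (G * H)))
    ≡⟨ ∑-blocks G H _ ⟩
  ∑ G (λ k → ∑ H (λ b → 𝟙 (coprime? (k * H + b) (G * H))))
    ≡⟨ ∑-cong G (λ k _ → ∑-cong H (λ b _ → split k b)) ⟩
  ∑ G (λ k → ∑ H (λ b → 𝟙 (coprime? b H) * 𝟙 (coprime? (k * H + b) G)))
    ≡⟨ ∑-swap G H _ ⟩
  ∑ H (λ b → ∑ G (λ k → 𝟙 (coprime? b H) * 𝟙 (coprime? (k * H + b) G)))
    ≡⟨ ∑-cong H (λ b _ → ∑-*ˡ G (𝟙 (coprime? b H)) _) ⟩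
  ∑ H (λ b → 𝟙 (coprime? b H) * ∑ G (λ k → 𝟙 (coprime? (k * H + b) G)))
    ≡⟨ ∑-cong H (λ b _ → cong (𝟙 (coprime? b H) *_) (progression-units G⊥H b)) ⟩
  ∑ H (λ b → 𝟙 (coprime? b H) * φ G)
    ≡⟨ ∑-*ʳ H _ (φ G) ⟩
  ∑ H (λ b → 𝟙 (coprime? b H)) * φ G
    ≡⟨ cong (_* φ G) (φ-as-∑ H) ⟨
  φ H * φ G
    ≡⟨ *-comm (φ H) (φ G) ⟩
  φ G * φ H
    ∎
  where
  open ≡-Reasoning
  split : ∀ k b → 𝟙 (coprime? (k * H + b) (G * H)) ≡ 𝟙 (coprime? b H) * 𝟙 (coprime? (k * H + b) G)
  split k b = trans (𝟙-cong unit⇒ ⇒unit _ (coprime? b H ×-dec coprime? u G))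
                    (𝟙-× (coprime? b H) (coprime? u G))
    where
    u : ℕ
    u = k * H + b
    u≡b : u % H ≡ b % H
    u≡b = trans (%-congˡ (+-comm (k * H) b)) ([m+kn]%n≡m%n b k H)
    unit⇒ : Coprime u (G * H) → Coprime b H × Coprime u G
    unit⇒ u⊥GH = coprime-mod u≡b (coprime-∣ ∣-refl (n∣m*n G) u⊥GH) , coprime-∣ ∣-refl (m∣m*n H) u⊥GH
    ⇒unit : Coprime b H × Coprime u G → Coprime u (G * H)
    ⇒unit (b⊥H , u⊥G) = coprime-* u⊥G (coprime-mod (sym u≡b) b⊥H)

SumFormula : ℕ → ℕ → ℕ → Set
SumFormula g m d = (φ g * sum (scaledUnits m d) ≡ sum (Units m))
                 × (2 * φ g * sum (scaledUnits m d) ≡ m * φ m)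

module TwoFactors (G H : ℕ) .{{_ : NonZero G}} .{{_ : NonZero H}} (G⊥H : Coprime G H)
                  (d : ℕ) (G∣d : G ∣ d) (H∣d∸1 : H ∣ d ∸ 1) (0<d : 0 < d) (d<m : d < G * H) where

  m : ℕ
  m = G * H

  G∣m : G ∣ m
  G∣m = m∣m*n H

  H∣m : H ∣ m
  H∣m = n∣m*n G

  -- if H were 1 then d would be a positive multiple of m = G below m
  H≢1 : H ≢ 1
  H≢1 H≡1 = <⇒≱ d<m (subst (_≤ d) (sym m≡G) (∣⇒≤ {{>-nonZero 0<d}} G∣d))
    where
    m≡G : m ≡ G
    m≡G = trans (cong (G *_) H≡1) (*-identityʳ G)

  -- multiplication by d ≡ 1 is the identity modulo H
  d*u≡u[H] : ∀ u → (d * u) % H ≡ u % H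
  d*u≡u[H] u = %-*-≡1 u (trans (%-congˡ (sym (m+[n∸m]≡n 0<d))) (%-+-multiple 1 H∣d∸1))

  -- the characterisation of d·U inside [0, m)
  Target : ℕ → Set
  Target v = G ∣ v × Coprime v H

  target? : Decidable Target
  target? v = G ∣? v ×-dec coprime? v H

  InDU : ℕ → Set
  InDU v = Any (λ u → (d * u) mod m ≡ v) (Units m)

  inDU? : Decidable InDU
  inDU? v = any? (λ u → (d * u) mod m ≟ v) (Units m)

  -- d·u is divisible by G, and coprime to H since d·u ≡ u (mod H)
  inDU⇒target : ∀ {v} → InDU v → Target v
  inDU⇒target any with find any
  ... | u , u∈U , du≡v = subst Target (trans (sym (mod≡% (d * u) m)) du≡v) (G∣v , v⊥H)
    where
    u⊥m : Coprime u m
    u⊥m = proj₂ (∈-filter⁻ (λ k → coprime? k m) {xs = upTo m} u∈U)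
    G∣v : G ∣ (d * u) % m
    G∣v = %-presˡ-∣ (∣m⇒∣m*n u G∣d) G∣m
    v⊥H : Coprime ((d * u) % m) H
    v⊥H = coprime-mod (sym (trans (m∣n⇒o%n%m≡o%m H m (d * u) H∣m) (d*u≡u[H] u)))
                      (coprime-∣ ∣-refl H∣m u⊥m)

  -- conversely v = d·u₀ for the unit u₀ = 1 + v + (m ∸ d), which is
  -- ≡ 1 (mod G) and ≡ v (mod H); the equation is checked modulo G and H
  target⇒inDU : ∀ {v} → v < m → Target v → InDU v
  target⇒inDU {v} v<m (G∣v , v⊥H) = lose u∈U du≡v
    where
    u₀ : ℕ
    u₀ = suc (v + (m ∸ d))
    u₀≡1[G] : u₀ % G ≡ 1 % G
    u₀≡1[G] = %-+-multiple 1 (∣m∣n⇒∣m+n G∣v (∣-complement G∣m (<⇒≤ d<m) G∣d))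
    d∸1+[1+m∸d]≡m : (d ∸ 1) + suc (m ∸ d) ≡ m
    d∸1+[1+m∸d]≡m = begin
      (d ∸ 1) + suc (m ∸ d)   ≡⟨ +-suc (d ∸ 1) (m ∸ d) ⟩
      suc (d ∸ 1) + (m ∸ d)   ≡⟨ cong (_+ (m ∸ d)) (m+[n∸m]≡n 0<d) ⟩
      d + (m ∸ d)             ≡⟨ m+[n∸m]≡n (<⇒≤ d<m) ⟩
      m                       ∎
      where open ≡-Reasoning
    u₀≡v[H] : u₀ % H ≡ v % H
    u₀≡v[H] = trans (%-congˡ (sym (+-suc v (m ∸ d))))
                    (%-+-multiple v (∣m+n∣m⇒∣n (subst (H ∣_) (sym d∸1+[1+m∸d]≡m) H∣m) H∣d∸1))
    u₀⊥m : Coprime u₀ m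
    u₀⊥m = coprime-* (coprime-mod (sym u₀≡1[G]) (coprime-1ˡ G)) (coprime-mod (sym u₀≡v[H]) v⊥H)
    u : ℕ
    u = u₀ % m
    u∈U : u ∈ Units m
    u∈U = ∈-filter⁺ (λ k → coprime? k m) (∈-upTo⁺ (m%n<n u₀ m))
                    (coprime-mod (sym (m%n%n≡m%n u₀ m)) u₀⊥m)
    du₀≡v[G] : (d * u₀) % G ≡ v % G
    du₀≡v[G] = trans (n∣m⇒m%n≡0 _ G (∣m⇒∣m*n u₀ G∣d)) (sym (n∣m⇒m%n≡0 v G G∣v))
    du≡v : (d * u) mod m ≡ v
    du≡v = begin
      (d * u) mod m      ≡⟨ mod≡% (d * u) m ⟩
      (d * u) % m        ≡⟨ %-*-reduceʳ d u₀ m ⟩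
      (d * u₀) % m       ≡⟨ crt G⊥H du₀≡v[G] (trans (d*u≡u[H] u₀) u₀≡v[H]) ⟩
      v % m              ≡⟨ m<n⇒m%n≡m v<m ⟩
      v                  ∎
      where open ≡-Reasoning

  sum-dU : sum (scaledUnits m d) ≡ ∑ m (λ v → 𝟙 (target? v) * v)
  sum-dU = trans (sum-filter-upTo inDU? m)
    (∑-cong m (λ v v<m → cong (_* v) (𝟙-cong inDU⇒target (target⇒inDU v<m) (inDU? v) (target? v))))

  -- |d·U| = φ(H): the targets are the multiples q·G with q a unit modulo H
  count-dU : ∑ m (λ v → 𝟙 (target? v)) ≡ φ H
  count-dU = begin
    ∑ m (λ v → 𝟙 (target? v))
      ≡⟨ ∑-cong m (λ v _ → 𝟙-× (G ∣? v) (coprime? v H)) ⟩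
    ∑ (G * H) (λ v → 𝟙 (G ∣? v) * 𝟙 (coprime? v H))
      ≡⟨ cong (λ n → ∑ n (λ v → 𝟙 (G ∣? v) * 𝟙 (coprime? v H))) (*-comm G H) ⟩
    ∑ (H * G) (λ v → 𝟙 (G ∣? v) * 𝟙 (coprime? v H))
      ≡⟨ ∑-multiples H G (λ v → 𝟙 (coprime? v H)) ⟩
    ∑ H (λ q → 𝟙 (coprime? (q * G) H))
      ≡⟨ ∑-cong H (λ q _ → 𝟙-cong (coprime-∣ (m∣m*n G) ∣-refl) (multiple-unit q) _ _) ⟩
    ∑ H (λ q → 𝟙 (coprime? q H))
      ≡⟨ φ-as-∑ H ⟨
    φ H
      ∎
    where
    open ≡-Reasoning
    multiple-unit : ∀ q → Coprime q H → Coprime (q * G) H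
    multiple-unit q q⊥H = Coprime.sym (coprime-* (Coprime.sym q⊥H) (Coprime.sym G⊥H))

  ¬target-0 : ¬ Target 0
  ¬target-0 (_ , 0⊥H) = H≢1 (coprime-0⇒≡1 0⊥H)

  target-complement : ∀ {v} → v ≤ m → Target v → Target (m ∸ v)
  target-complement v≤m (G∣v , v⊥H) = ∣-complement G∣m v≤m G∣v , coprime-complement H∣m v≤m v⊥H

  twice-sum-dU : 2 * sum (scaledUnits m d) ≡ m * φ H
  twice-sum-dU = begin
    2 * sum (scaledUnits m d)                ≡⟨ cong (2 *_) sum-dU ⟩
    2 * ∑ m (λ v → 𝟙 (target? v) * v)        ≡⟨ ∑-symmetric-set m target? ¬target-0 target-complement ⟩
    m * ∑ m (λ v → 𝟙 (target? v))            ≡⟨ cong (m *_) count-dU ⟩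
    m * φ H                                  ∎
    where open ≡-Reasoning

  twice-sum-U : 2 * sum (Units m) ≡ m * φ m
  twice-sum-U = begin
    2 * sum (Units m)                               ≡⟨ cong (2 *_) (sum-filter-upTo unit? m) ⟩
    2 * ∑ m (λ v → 𝟙 (unit? v) * v)                 ≡⟨ ∑-symmetric-set m unit? ¬unit-0 (coprime-complement ∣-refl) ⟩
    m * ∑ m (λ v → 𝟙 (unit? v))                     ≡⟨ cong (m *_) (φ-as-∑ m) ⟨
    m * φ m                                         ∎
    where
    open ≡-Reasoning
    unit? : Decidable (λ v → Coprime v m)
    unit? v = coprime? v m
    ¬unit-0 : ¬ Coprime 0 m
    ¬unit-0 0⊥m = H≢1 (coprime-0⇒≡1 (coprime-∣ ∣-refl H∣m 0⊥m))

  sumFormula : SumFormula G m d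
  sumFormula = weighted , doubled
    where
    open ≡-Reasoning
    S : ℕ
    S = sum (scaledUnits m d)
    doubled : 2 * φ G * S ≡ m * φ m
    doubled = begin
      2 * φ G * S          ≡⟨ swap-front 2 (φ G) S ⟩
      φ G * (2 * S)        ≡⟨ cong (φ G *_) twice-sum-dU ⟩
      φ G * (m * φ H)      ≡⟨ left-comm (φ G) m (φ H) ⟩
      m * (φ G * φ H)      ≡⟨ cong (m *_) (φ-multiplicative G H G⊥H) ⟨
      m * φ m              ∎
      where
      swap-front : ∀ a b c → a * b * c ≡ b * (a * c)
      swap-front = solve-∀
      left-comm : ∀ a b c → a * (b * c) ≡ b * (a * c)
      left-comm = solve-∀
    weighted : φ G * S ≡ sum (Units m)
    weighted = *-cancelˡ-≡ (φ G * S) (sum (Units m)) 2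
      (trans (sym (*-assoc 2 (φ G) S)) (trans doubled (sym twice-sum-U)))

-- G and H are automatically nonzero, since 0 < d < G·H
twoFactorTheorem : ∀ G H d → Coprime G H → G ∣ d → H ∣ d ∸ 1 → 0 < d → d < G * H →
                   SumFormula G (G * H) d
twoFactorTheorem G H d G⊥H G∣d H∣d∸1 0<d d<m =
  TwoFactors.sumFormula G H {{m*n≢0⇒m≢0 G {{m≢0}}}} {{m*n≢0⇒n≢0 G {{m≢0}}}} G⊥H d G∣d H∣d∸1 0<d d<m
  where
  m≢0 : NonZero (G * H)
  m≢0 = >-nonZero (<-trans 0<d d<m)

product-map-* : ∀ {A : Set} (f g h : A → ℕ) → (∀ x → f x ≡ g x * h x) →
                ∀ xs → product (map f xs) ≡ product (map g xs) * product (map h xs)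
product-map-* f g h f≡gh []       = refl
product-map-* f g h f≡gh (x ∷ xs) = begin
  f x * product (map f xs)
    ≡⟨ cong₂ _*_ (f≡gh x) (product-map-* f g h f≡gh xs) ⟩
  (g x * h x) * (product (map g xs) * product (map h xs))
    ≡⟨ interchange (g x) (h x) (product (map g xs)) (product (map h xs)) ⟩
  (g x * product (map g xs)) * (h x * product (map h xs))
    ∎
  where
  open ≡-Reasoning
  interchange : ∀ a b c d → (a * b) * (c * d) ≡ (a * c) * (b * d)
  interchange = solve-∀

coprime-product : ∀ {x} ys → All (Coprime x) ys → Coprime x (product ys)
coprime-product {x} []       []           = coprime-1ʳ x
coprime-product     (y ∷ ys) (x⊥y ∷ x⊥ys) = coprime-* x⊥y (coprime-product ys x⊥ys)

coprime-products : ∀ xs ys → All (λ x → All (Coprime x) ys) xs → Coprime (product xs) (product ys)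
coprime-products []       ys []              = coprime-1ˡ (product ys)
coprime-products (x ∷ xs) ys (x⊥ys ∷ xs⊥ys) = Coprime.sym (coprime-*
  (Coprime.sym (coprime-product ys x⊥ys)) (Coprime.sym (coprime-products xs ys xs⊥ys)))

pairwise-coprime-∣ : ∀ {n} xs → AllPairs Coprime xs → All (_∣ n) xs → product xs ∣ n
pairwise-coprime-∣ []       []         []          = 1∣ _
pairwise-coprime-∣ (x ∷ xs) (x⊥ ∷ ⊥xs) (x∣n ∷ xs∣n) =
  coprime-∣-product (coprime-product xs x⊥) x∣n (pairwise-coprime-∣ xs ⊥xs xs∣n)

select : Bool → ℕ → ℕ
select b x = if b then x else 1

select-∣ : ∀ b x → select b x ∣ x
select-∣ true  x = ∣-refl
select-∣ false x = 1∣ x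

select-split : ∀ b x → x ≡ select b x * select (not b) x
select-split true  x = sym (*-identityʳ x)
select-split false x = sym (*-identityˡ x)

-- The modulus m = ∏ p_i^{e_i} splits as G·H, G collecting the prime powers
-- with i ∈ I and H the others; the hypotheses on d say G ∣ d and H ∣ d ∸ 1.
module PrimePowers (r : ℕ) (p e : Fin r → ℕ) (prime : ∀ i → Prime (p i))
                   (p-injective : Injective _≡_ _≡_ p) (I : Fin r → Bool) where

  q : Fin r → ℕ
  q = ppow p e

  inG inH : Fin r → ℕ
  inG i = select (I i) (q i)
  inH i = select (not (I i)) (q i)

  G H : ℕ
  G = product (map inG (allFin r))
  H = product (map inH (allFin r))

  -- each q i splits as inG i · inH i
  m≡GH : modulus r p e ≡ G * H
  m≡GH = product-map-* q inG inH (λ i → select-split (I i) (q i)) (allFin r)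

  q-coprime : ∀ {i j} → i ≢ j → Coprime (q i) (q j)
  q-coprime {i} {j} i≢j = coprime-pow (e i) (e j) p⊥p
    where
    p⊥p : Coprime (p i) (p j)
    p⊥p (k∣pi , k∣pj) with prime⇒irreducible (prime i) k∣pi | prime⇒irreducible (prime j) k∣pj
    ... | inj₁ k≡1 | _        = k≡1
    ... | inj₂ _   | inj₁ k≡1 = k≡1
    ... | inj₂ k≡pi | inj₂ k≡pj = ⊥-elim (i≢j (p-injective (trans (sym k≡pi) k≡pj)))

  selected-pairwise : ∀ (J : Fin r → Bool) → AllPairs Coprime (map (λ i → select (J i) (q i)) (allFin r))
  selected-pairwise J = AllPairsₚ.map⁺ (AllPairs.map (λ {i} {j} → selected-coprime i j) (allFin⁺ r))
    where
    selected-coprime : ∀ i j → i ≢ j → Coprime (select (J i) (q i)) (select (J j) (q j))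
    selected-coprime i j i≢j = coprime-∣ (select-∣ (J i) (q i)) (select-∣ (J j) (q j)) (q-coprime i≢j)

  -- a factor of G and a factor of H are coprime: distinct indices give
  -- coprime prime powers, and for equal indices one of the two is 1
  inG⊥inH : ∀ i j → Coprime (inG i) (inH j)
  inG⊥inH i j with i ≟ᶠ j
  ... | no i≢j = coprime-∣ (select-∣ (I i) (q i)) (select-∣ (not (I j)) (q j)) (q-coprime i≢j)
  ... | yes refl with I i
  ...   | true  = coprime-1ʳ (q i)
  ...   | false = coprime-1ˡ (q i)

  G⊥H : Coprime G H
  G⊥H = coprime-products (map inG (allFin r)) (map inH (allFin r))
    (Allₚ.map⁺ (Allₚ.tabulate⁺ (λ i → Allₚ.map⁺ (Allₚ.tabulate⁺ (inG⊥inH i)))))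

  G∣d : ∀ {d} → (∀ i → I i ≡ true → q i ∣ d) → G ∣ d
  G∣d {d} hI = pairwise-coprime-∣ (map inG (allFin r)) (selected-pairwise I)
    (Allₚ.map⁺ (Allₚ.tabulate⁺ inG∣d))
    where
    inG∣d : ∀ i → inG i ∣ d
    inG∣d i with I i in Ii
    ... | true  = hI i Ii
    ... | false = 1∣ d

  H∣d∸1 : ∀ {d} → (∀ i → I i ≡ false → d mod q i ≡ 1 mod q i) → H ∣ d ∸ 1
  H∣d∸1 {d} hF = pairwise-coprime-∣ (map inH (allFin r)) (selected-pairwise (not ∘ I))
    (Allₚ.map⁺ (Allₚ.tabulate⁺ inH∣d∸1))
    where
    inH∣d∸1 : ∀ i → inH i ∣ d ∸ 1
    inH∣d∸1 i with I i in Ii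
    ... | true  = 1∣ (d ∸ 1)
    ... | false = mod-≡⇒∣∸ (q i) (sym (hF i Ii))

-- d·U has sum Σ U / φ(g_I) = m·φ(m) / (2·φ(g_I))
mainTheorem18 : (r : ℕ) (p e : Fin r → ℕ) →
    (∀ i → Prime (p i)) → Injective _≡_ _≡_ p → (∀ i → 1 ≤ e i) →
    (I : Fin r → Bool) (d : ℕ) →
    d < modulus r p e →
    (∀ i → I i ≡ true → ppow p e i ∣ d) →
    (∀ i → I i ≡ false → d mod ppow p e i ≡ 1 mod ppow p e i) →
    d ≢ 0 →
    (φ (gI r p e I) * sum (scaledUnits (modulus r p e) d) ≡ sum (Units (modulus r p e)))
    × (2 * φ (gI r p e I) * sum (scaledUnits (modulus r p e) d)
        ≡ modulus r p e * φ (modulus r p e))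
mainTheorem18 r p e prime p-injective _ I d d<m hI hF d≢0 =
  subst (λ m → SumFormula G m d) (sym m≡GH)
    (twoFactorTheorem G H d G⊥H (G∣d hI) (H∣d∸1 hF) (n≢0⇒n>0 d≢0) (subst (d <_) m≡GH d<m))
  where open PrimePowers r p e prime p-injective I
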